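{- Let $G$ be a $3$-factor-critical graph of order at least $4$ and let $H$ be a subgraph of $G$. If $|V(H)|$ is odd and $N_G(V(H))$ is a vertex cut of $G$, then $|N_G(V(H))|\ge 4$.
   Context: All graphs are simple and finite. A graph $G$ of order $n$ is $3$-factor-critical (with $3<n$) if for every set $S$ of $3$ vertices, $G-S$ has a perfect matching. For $X\subseteq V(G)$, $N_G(X)$ denotes the set of vertices in $V(G)\setminus X$ adjacent to at least one vertex of $X$. A set $X\subseteq V(G)$ is a vertex cut if $G-X$ has more components than $G$. -}

module Defs where

open import Data.Nat using (ℕ; zero; suc; _<_)
open import Data.Bool using (Bool; true; false; _∧_; _∨_; not)
open import Data.Fin using (Fin; zero; suc)
open import Data.Fin.Subset using (Subset; _∈_; _∉_; ∣_∣)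
open import Data.Vec using (tabulate; lookup)
open import Data.Product using (Σ; ∃; _×_; _,_)
open import Relation.Binary.PropositionalEquality using (_≡_; _≢_)
open import Relation.Nullary using (¬_)
open import Function.Definitions using (Surjective)
open import Function using (_⇔_)

record Graph (n : ℕ) : Set where
  field
    adj    : Fin n → Fin n → Bool
    sym    : ∀ u v → adj u v ≡ adj v u
    irrefl : ∀ v → adj v v ≡ false
open Graph public

Adj : ∀ {n} → Graph n → Fin n → Fin n → Set
Adj G u v = adj G u v ≡ true

record Subgraph {n : ℕ} (G : Graph n) : Set₁ where
  field
    VH      : Subset n
    EH      : Fin n → Fin n → Set
    EH⊆EG   : ∀ u v → EH u v → Adj G u v
    EH-ends : ∀ u v → EH u v → (u ∈ VH) × (v ∈ VH)
    EH-sym  : ∀ u v → EH u v → EH v u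
open Subgraph public

-- G - S has a perfect matching: an involution on V(G) \ S pairing
-- each vertex with an adjacent (hence distinct) vertex outside S.
HasPerfectMatchingAvoiding : ∀ {n} → Graph n → Subset n → Set
HasPerfectMatchingAvoiding {n} G S =
  Σ (Fin n → Fin n) λ p →
    ∀ v → v ∉ S → (p v ∉ S) × Adj G v (p v) × (p (p v) ≡ v)

ThreeFactorCritical : ∀ {n} → Graph n → Set
ThreeFactorCritical {n} G =
  (3 < n) × (∀ (S : Subset n) → ∣ S ∣ ≡ 3 → HasPerfectMatchingAvoiding G S)

data Reach {n : ℕ} (G : Graph n) (X : Subset n) (u : Fin n) : Fin n → Set where
  here : u ∉ X → Reach G X u u
  step : ∀ {w v} → Reach G X u w → Adj G w v → v ∉ X → Reach G X u v

VOut : ∀ {n} → Subset n → Set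
VOut {n} X = Σ (Fin n) λ v → v ∉ X

-- G - X has exactly k components: there is a surjective labelling of the
-- vertices of G - X by Fin k whose fibres are exactly the connected classes.
HasComponents : ∀ {n} → Graph n → Subset n → ℕ → Set
HasComponents {n} G X k =
  Σ (VOut X → Fin k) λ c →
    Surjective _≡_ _≡_ c ×
    (∀ (u v : VOut X) → (c u ≡ c v) ⇔ Reach G X (Σ.proj₁ u) (Σ.proj₁ v))
  where open Σ

∅ : ∀ {n} → Subset n
∅ {n} = tabulate (λ _ → false)

VertexCut : ∀ {n} → Graph n → Subset n → Set
VertexCut G X = ∃ λ k → ∃ λ m → HasComponents G ∅ k × HasComponents G X m × k < m

anyFin : ∀ {n} → (Fin n → Bool) → Bool
anyFin {zero}  f = false
anyFin {suc n} f = f zero ∨ anyFin (λ i → f (suc i))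

Nbhd : ∀ {n} → Graph n → Subset n → Subset n
Nbhd G X = tabulate λ v → not (lookup X v) ∧ anyFin (λ u → lookup X u ∧ adj G u v)

{-# OPTIONS --safe #-}
-- If N(C) ⊆ S and G - S has a perfect matching, the matching pairs off the vertices of
-- C - S among themselves, so |C - S| is even.  Were |N(V(H))| = 3, taking S = N(V(H))
-- would make |V(H)| even.  Were a vertex cut X of size at most 2, pick c in a component C
-- of G - X and d outside C ∪ X, and enlarge X to a 2-set T avoiding c and d (n ≥ 4): the
-- 3-sets T ∪ {c} and T ∪ {d} leave |C - T| - 1 and |C - T| vertices of C, not both even.
module Submission where

open import Data.Bool using (Bool; true; false; _∧_; _∨_; not)
open import Data.Bool.Properties using (∨-zeroʳ)
open import Data.Fin using (Fin; zero; suc; _≟_)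
open import Data.Fin.Properties using (toℕ<n)
open import Data.Fin.Subset
  using (Subset; inside; outside; _∈_; _∉_; _⊆_; _⊂_; ∣_∣; ⁅_⁆; ∁; _∪_; _∩_; _─_; _-_; Empty)
open import Data.Fin.Subset.Induction using (Acc; acc; ⊂-wellFounded)
open import Data.Fin.Subset.Properties
  using ( _∈?_; drop-there; drop-∷-⊆; drop-∷-Empty; out⊆; in⊆in; s⊆s; ⊆-refl; ⊆-trans
        ; ⊆-⊂-trans; nonempty?; Empty-unique; ∣⊥∣≡0; x∈⁅x⁆; x∈⁅y⁆⇒x≡y; x≢y⇒x∉⁅y⁆
        ; x∉⁅y⁆⇒x≢y; ∣⁅x⁆∣≡1; x∉p⇒x∈∁p; x∈∁p⇒x∉p; ∣∁p∣≡n∸∣p∣; x∈p∩q⁻; p⊆p∪q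
        ; p─⊥≡p; p─q⊆p; p─q─r≡p─q∪r; x∈p∧x∉q⇒x∈p─q; x∈p∧x≢y⇒x∈p-y; x∈p⇒p-x⊂p)
open import Data.Nat using (ℕ; zero; suc; _+_; _∸_; _≤_; _<_; _%_; z≤n; s≤s; s≤s⁻¹; _≤?_)
open import Data.Nat.Divisibility using (_∣_; _∣0; n∣n; ∣1⇒≡1; ∣m∣n⇒∣m+n; ∣m+n∣m⇒∣n; n∣m⇒m%n≡0)
open import Data.Nat.Properties
  using (+-suc; +-comm; ≤-trans; ≤-antisym; ≰⇒>; ≮⇒≥; ≤∧≢⇒<; ∸-monoˡ-≤; module ≤-Reasoning)
open import Data.Product using (∃-syntax; _×_; _,_; proj₁; proj₂)
open import Data.Vec using ([]; _∷_; lookup; tabulate; here; there)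
open import Data.Vec.Properties using (lookup∘tabulate; lookup⇒[]=; []=⇒lookup)
open import Function using (_∘_; Equivalence)
open import Level using (Level)
open import Relation.Binary.PropositionalEquality using (_≡_; _≢_; refl; sym; trans; cong; cong₂; subst)
open import Relation.Nullary using (¬_; Dec; yes; no; does; contradiction)
open import Relation.Nullary.Decidable using (dec-true)
import Relation.Nullary.Decidable as Dec
open import Relation.Unary using (Pred; Decidable)

open import Defs hiding (sym)

private
  variable
    ℓ : Level
    n m : ℕ
    p q : Subset n
    x : Fin n
    G : Graph n
    X : Subset n

x∈p─q⁻ : ∀ (p q : Subset n) → x ∈ p ─ q → x ∈ p × x ∉ q
x∈p─q⁻ (s ∷ p) (outside ∷ q) here = here , λ ()
x∈p─q⁻ (s ∷ p) (t ∷ q) (there x∈p─q) with x∈p─q⁻ p q x∈p─q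
... | x∈p , x∉q = there x∈p , x∉q ∘ drop-there

x∈p⇒suc∣p-x∣≡∣p∣ : ∀ (p : Subset n) → x ∈ p → suc ∣ p - x ∣ ≡ ∣ p ∣
x∈p⇒suc∣p-x∣≡∣p∣ (inside  ∷ p) here        = cong (suc ∘ ∣_∣) (p─⊥≡p p)
x∈p⇒suc∣p-x∣≡∣p∣ (inside  ∷ p) (there x∈p) = cong suc (x∈p⇒suc∣p-x∣≡∣p∣ p x∈p)
x∈p⇒suc∣p-x∣≡∣p∣ (outside ∷ p) (there x∈p) = x∈p⇒suc∣p-x∣≡∣p∣ p x∈p

Empty[p∩q]⇒p─q≡p : ∀ (p q : Subset n) → Empty (p ∩ q) → p ─ q ≡ p
Empty[p∩q]⇒p─q≡p []            []            _   = refl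
Empty[p∩q]⇒p─q≡p (inside  ∷ p) (inside  ∷ q) p∩q=∅ = contradiction (zero , here) p∩q=∅
Empty[p∩q]⇒p─q≡p (outside ∷ p) (inside  ∷ q) p∩q=∅ =
  cong (outside ∷_) (Empty[p∩q]⇒p─q≡p p q (drop-∷-Empty p∩q=∅))
Empty[p∩q]⇒p─q≡p (s       ∷ p) (outside ∷ q) p∩q=∅ =
  cong (s ∷_) (Empty[p∩q]⇒p─q≡p p q (drop-∷-Empty p∩q=∅))

Empty[p∩q]⇒∣p∪q∣≡∣p∣+∣q∣ : ∀ (p q : Subset n) → Empty (p ∩ q) → ∣ p ∪ q ∣ ≡ ∣ p ∣ + ∣ q ∣
Empty[p∩q]⇒∣p∪q∣≡∣p∣+∣q∣ []            []            _   = refl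
Empty[p∩q]⇒∣p∪q∣≡∣p∣+∣q∣ (inside  ∷ p) (inside  ∷ q) p∩q=∅ = contradiction (zero , here) p∩q=∅
Empty[p∩q]⇒∣p∪q∣≡∣p∣+∣q∣ (inside  ∷ p) (outside ∷ q) p∩q=∅ =
  cong suc (Empty[p∩q]⇒∣p∪q∣≡∣p∣+∣q∣ p q (drop-∷-Empty p∩q=∅))
Empty[p∩q]⇒∣p∪q∣≡∣p∣+∣q∣ (outside ∷ p) (inside  ∷ q) p∩q=∅ =
  trans (cong suc (Empty[p∩q]⇒∣p∪q∣≡∣p∣+∣q∣ p q (drop-∷-Empty p∩q=∅))) (sym (+-suc ∣ p ∣ ∣ q ∣))
Empty[p∩q]⇒∣p∪q∣≡∣p∣+∣q∣ (outside ∷ p) (outside ∷ q) p∩q=∅ =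
  Empty[p∩q]⇒∣p∪q∣≡∣p∣+∣q∣ p q (drop-∷-Empty p∩q=∅)

x∉p⇒Empty[p∩⁅x⁆] : ∀ (p : Subset n) → x ∉ p → Empty (p ∩ ⁅ x ⁆)
x∉p⇒Empty[p∩⁅x⁆] p x∉p (y , y∈p∩⁅x⁆) with x∈p∩q⁻ p _ y∈p∩⁅x⁆
... | y∈p , y∈⁅x⁆ = x∉p (subst (_∈ p) (x∈⁅y⁆⇒x≡y _ y∈⁅x⁆) y∈p)

x∉p⇒∣p∪⁅x⁆∣≡∣p∣+1 : ∀ (p : Subset n) → x ∉ p → ∣ p ∪ ⁅ x ⁆ ∣ ≡ ∣ p ∣ + 1
x∉p⇒∣p∪⁅x⁆∣≡∣p∣+1 {x = x} p x∉p =
  trans (Empty[p∩q]⇒∣p∪q∣≡∣p∣+∣q∣ p ⁅ x ⁆ (x∉p⇒Empty[p∩⁅x⁆] p x∉p)) (cong (∣ p ∣ +_) (∣⁅x⁆∣≡1 x))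

x∉p⇒p─[q∪⁅x⁆]≡p─q : ∀ (p q : Subset n) → x ∉ p → p ─ (q ∪ ⁅ x ⁆) ≡ p ─ q
x∉p⇒p─[q∪⁅x⁆]≡p─q {x = x} p q x∉p = trans (sym (p─q─r≡p─q∪r p q ⁅ x ⁆))
  (Empty[p∩q]⇒p─q≡p (p ─ q) ⁅ x ⁆ (x∉p⇒Empty[p∩⁅x⁆] (p ─ q) (x∉p ∘ p─q⊆p p q)))

x∈p─q⇒suc∣p─[q∪⁅x⁆]∣≡∣p─q∣ : ∀ (p q : Subset n) → x ∈ p ─ q → suc ∣ p ─ (q ∪ ⁅ x ⁆) ∣ ≡ ∣ p ─ q ∣
x∈p─q⇒suc∣p─[q∪⁅x⁆]∣≡∣p─q∣ {x = x} p q x∈p─q =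
  trans (cong (suc ∘ ∣_∣) (sym (p─q─r≡p─q∪r p q ⁅ x ⁆))) (x∈p⇒suc∣p-x∣≡∣p∣ (p ─ q) x∈p─q)

⊆-interpolate : p ⊆ q → ∣ p ∣ ≤ m → m ≤ ∣ q ∣ → ∃[ r ] p ⊆ r × r ⊆ q × ∣ r ∣ ≡ m
⊆-interpolate {p = []} {[]} _ _ z≤n = [] , ⊆-refl , ⊆-refl , refl
⊆-interpolate {p = inside ∷ p} {outside ∷ q} p⊆q _ _ = contradiction (p⊆q here) λ ()
⊆-interpolate {p = inside ∷ p} {inside ∷ q} p⊆q (s≤s lo) (s≤s hi)
  with ⊆-interpolate (drop-∷-⊆ p⊆q) lo hi
... | r , p⊆r , r⊆q , ∣r∣≡m = inside ∷ r , in⊆in p⊆r , in⊆in r⊆q , cong suc ∣r∣≡m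
⊆-interpolate {p = outside ∷ p} {outside ∷ q} p⊆q lo hi
  with ⊆-interpolate (drop-∷-⊆ p⊆q) lo hi
... | r , p⊆r , r⊆q , ∣r∣≡m = outside ∷ r , s⊆s p⊆r , s⊆s r⊆q , ∣r∣≡m
⊆-interpolate {p = outside ∷ p} {inside ∷ q} {m} p⊆q lo hi with m ≤? ∣ q ∣
... | yes m≤∣q∣ with ⊆-interpolate (drop-∷-⊆ p⊆q) lo m≤∣q∣
...   | r , p⊆r , r⊆q , ∣r∣≡m = outside ∷ r , s⊆s p⊆r , out⊆ r⊆q , ∣r∣≡m
⊆-interpolate {p = outside ∷ p} {inside ∷ q} {m} p⊆q lo hi | no m≰∣q∣ =
  inside ∷ q , p⊆q , ⊆-refl , ≤-antisym (≰⇒> m≰∣q∣) hi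

FixedPointFreeInvolutionOn : Subset n → (Fin n → Fin n) → Set
FixedPointFreeInvolutionOn p f = ∀ {x} → x ∈ p → f x ∈ p × f x ≢ x × f (f x) ≡ x

fixedPointFreeInvolution⇒2∣∣p∣ : ∀ (p : Subset n) f → FixedPointFreeInvolutionOn p f → 2 ∣ ∣ p ∣
fixedPointFreeInvolution⇒2∣∣p∣ {n} p f = go p (⊂-wellFounded p)
  where
  f-flip : ∀ {y z} → f (f y) ≡ y → f y ≡ z → y ≡ f z
  f-flip ffy≡y fy≡z = trans (sym ffy≡y) (cong f fy≡z)

  go : ∀ p → Acc _⊂_ p → FixedPointFreeInvolutionOn p f → 2 ∣ ∣ p ∣
  go p (acc rec) inv with nonempty? p
  ... | no p=∅ = subst (2 ∣_) (sym (trans (cong ∣_∣ (Empty-unique p=∅)) (∣⊥∣≡0 n))) (2 ∣0)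
  ... | yes (x , x∈p) with inv x∈p
  ...   | fx∈p , fx≢x , ffx≡x = subst (2 ∣_) 2+∣p′∣≡∣p∣ (∣m∣n⇒∣m+n n∣n (go p′ (rec p′⊂p) inv′))
    where
    p′ = p - x - f x
    2+∣p′∣≡∣p∣ : 2 + ∣ p′ ∣ ≡ ∣ p ∣
    2+∣p′∣≡∣p∣ = trans (cong suc (x∈p⇒suc∣p-x∣≡∣p∣ (p - x) (x∈p∧x≢y⇒x∈p-y fx∈p fx≢x)))
                       (x∈p⇒suc∣p-x∣≡∣p∣ p x∈p)
    p′⊂p : p′ ⊂ p
    p′⊂p = ⊆-⊂-trans (p─q⊆p (p - x) ⁅ f x ⁆) (x∈p⇒p-x⊂p x∈p)
    inv′ : FixedPointFreeInvolutionOn p′ f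
    inv′ {y} y∈p′ with x∈p─q⁻ (p - x) ⁅ f x ⁆ y∈p′
    ... | y∈p-x , y∉⁅fx⁆ with x∈p─q⁻ p ⁅ x ⁆ y∈p-x
    ...   | y∈p , y∉⁅x⁆ with inv y∈p
    ...     | fy∈p , fy≢y , ffy≡y = x∈p∧x≢y⇒x∈p-y (x∈p∧x≢y⇒x∈p-y fy∈p fy≢x) fy≢fx , fy≢y , ffy≡y
      where
      fy≢x : f y ≢ x
      fy≢x = x∉⁅y⁆⇒x≢y y∉⁅fx⁆ ∘ f-flip ffy≡y
      fy≢fx : f y ≢ f x
      fy≢fx fy≡fx = x∉⁅y⁆⇒x≢y y∉⁅x⁆ (trans (f-flip ffy≡y fy≡fx) ffx≡x)

∈-tabulate⁺ : ∀ (f : Fin n → Bool) → f x ≡ true → x ∈ tabulate f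
∈-tabulate⁺ f fx≡true = lookup⇒[]= _ _ (trans (lookup∘tabulate f _) fx≡true)

∈-tabulate⁻ : ∀ (f : Fin n → Bool) → x ∈ tabulate f → f x ≡ true
∈-tabulate⁻ f x∈ = trans (sym (lookup∘tabulate f _)) ([]=⇒lookup x∈)

∉⇒lookup≡false : x ∉ p → lookup p x ≡ false
∉⇒lookup≡false {x = x} {p = p} x∉p with lookup p x in p[x]
... | true  = contradiction (lookup⇒[]= x p p[x]) x∉p
... | false = refl

anyFin⁺ : ∀ (f : Fin n → Bool) → f x ≡ true → anyFin f ≡ true
anyFin⁺ {x = zero} f fx≡true = cong (_∨ anyFin (f ∘ suc)) fx≡true
anyFin⁺ {x = suc x} f fx≡true = trans (cong (f zero ∨_) (anyFin⁺ (f ∘ suc) fx≡true)) (∨-zeroʳ (f zero))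

anyFin⁻ : ∀ {n} (f : Fin n → Bool) → anyFin f ≡ true → ∃[ x ] f x ≡ true
anyFin⁻ {suc n} f any≡true with f zero in f0
... | true  = zero , f0
... | false = let x , fx = anyFin⁻ (f ∘ suc) any≡true in suc x , fx

∈-Nbhd⁺ : ∀ (G : Graph n) {X u v} → u ∈ X → Adj G u v → v ∉ X → v ∈ Nbhd G X
∈-Nbhd⁺ G {X} {u} {v} u∈X u~v v∉X = ∈-tabulate⁺ _
  (cong₂ _∧_ (cong not (∉⇒lookup≡false v∉X))
             (anyFin⁺ (λ w → lookup X w ∧ adj G w v) (cong₂ _∧_ ([]=⇒lookup u∈X) u~v)))

∈-Nbhd⁻ : ∀ (G : Graph n) {X v} → v ∈ Nbhd G X → v ∉ X × ∃[ u ] u ∈ X × Adj G u v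
∈-Nbhd⁻ G {X} {v} v∈N with lookup X v in X[v] | ∈-tabulate⁻ _ v∈N
... | false | any≡true with anyFin⁻ (λ w → lookup X w ∧ adj G w v) any≡true
...   | u , Xu∧u~v with lookup X u in X[u] | adj G u v in u~v
...     | true | true = (λ v∈X → contradiction (trans (sym ([]=⇒lookup v∈X)) X[v]) λ ())
                      , u , lookup⇒[]= u X X[u] , u~v

Adj-irrefl : ∀ (G : Graph n) {v} → ¬ Adj G v v
Adj-irrefl G {v} v~v = contradiction (trans (sym v~v) (irrefl G v)) λ ()

perfectMatching⇒2∣∣C─S∣ : ∀ (G : Graph n) {C S} →
  HasPerfectMatchingAvoiding G S → Nbhd G C ⊆ S → 2 ∣ ∣ C ─ S ∣
perfectMatching⇒2∣∣C─S∣ G {C} {S} (f , matched) N[C]⊆S =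
  fixedPointFreeInvolution⇒2∣∣p∣ (C ─ S) f involution
  where
  involution : FixedPointFreeInvolutionOn (C ─ S) f
  involution {v} v∈C─S with x∈p─q⁻ C S v∈C─S
  ... | v∈C , v∉S with matched v v∉S
  ...   | fv∉S , v~fv , ffv≡v =
    x∈p∧x∉q⇒x∈p─q fv∈C fv∉S , (λ fv≡v → Adj-irrefl G (subst (Adj G v) fv≡v v~fv)) , ffv≡v
    where
    fv∈C : f v ∈ C
    fv∈C with f v ∈? C
    ... | yes fv∈C = fv∈C
    ... | no  fv∉C = contradiction (N[C]⊆S (∈-Nbhd⁺ G v∈C v~fv fv∉C)) fv∉S

Reach⇒source∉ : ∀ {G : Graph n} {u v} → Reach G X u v → u ∉ X
Reach⇒source∉ (here u∉X)     = u∉X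
Reach⇒source∉ (step u⇝w _ _) = Reach⇒source∉ u⇝w

Reach⇒target∉ : ∀ {G : Graph n} {u v} → Reach G X u v → v ∉ X
Reach⇒target∉ (here u∉X)     = u∉X
Reach⇒target∉ (step _ _ v∉X) = v∉X

reach? : HasComponents G X m → ∀ u v → Dec (Reach G X u v)
reach? {X = X} (c , _ , c≡⇔Reach) u v with u ∈? X | v ∈? X
... | yes u∈X | _        = no λ u⇝v → Reach⇒source∉ u⇝v u∈X
... | no  _   | yes v∈X  = no λ u⇝v → Reach⇒target∉ u⇝v v∈X
... | no  u∉X | no  v∉X  = Dec.map (c≡⇔Reach (u , u∉X) (v , v∉X)) (c (u , u∉X) ≟ c (v , v∉X))

subsetOf : {P : Pred (Fin n) ℓ} → Decidable P → Subset n
subsetOf P? = tabulate (does ∘ P?)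

∈-subsetOf⁺ : {P : Pred (Fin n) ℓ} (P? : Decidable P) → P x → x ∈ subsetOf P?
∈-subsetOf⁺ P? Px = ∈-tabulate⁺ _ (dec-true (P? _) Px)

∈-subsetOf⁻ : {P : Pred (Fin n) ℓ} (P? : Decidable P) → x ∈ subsetOf P? → P x
∈-subsetOf⁻ {x = x} P? x∈ with P? x | ∈-tabulate⁻ (does ∘ P?) x∈
... | yes Px | _ = Px

record Separation (G : Graph n) (X : Subset n) : Set where
  field
    side       : Subset n
    Nbhd⊆X     : Nbhd G side ⊆ X
    inner      : Fin n
    inner∈side : inner ∈ side
    inner∉X    : inner ∉ X
    outer      : Fin n
    outer∉side : outer ∉ side
    outer∉X    : outer ∉ X

components⇒Separation : HasComponents G X m → 2 ≤ m → Separation G X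
components⇒Separation {G = G} {X = X} components@(c , surj , c≡⇔Reach) (s≤s (s≤s _)) = record
  { side       = side
  ; Nbhd⊆X     = Nbhd⊆X
  ; inner      = proj₁ a
  ; inner∈side = ∈-subsetOf⁺ a⇝? (here (proj₂ a))
  ; inner∉X    = proj₂ a
  ; outer      = proj₁ b
  ; outer∉side = a≁b ∘ ∈-subsetOf⁻ a⇝?
  ; outer∉X    = proj₂ b
  }
  where
  a = proj₁ (surj zero)
  b = proj₁ (surj (suc zero))
  a⇝? : Decidable (Reach G X (proj₁ a))
  a⇝? = reach? components (proj₁ a)
  side = subsetOf a⇝?
  a≁b : ¬ Reach G X (proj₁ a) (proj₁ b)
  a≁b a⇝b with trans (sym (proj₂ (surj zero) refl))
                     (trans (Equivalence.from (c≡⇔Reach a b) a⇝b) (proj₂ (surj (suc zero)) refl))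
  ... | ()
  Nbhd⊆X : Nbhd G side ⊆ X
  Nbhd⊆X {v} v∈N with v ∈? X | ∈-Nbhd⁻ G v∈N
  ... | yes v∈X | _ = v∈X
  ... | no  v∉X | v∉side , u , u∈side , u~v =
    contradiction (∈-subsetOf⁺ a⇝? (step (∈-subsetOf⁻ a⇝? u∈side) u~v v∉X)) v∉side

vertexCut⇒Separation : VertexCut G X → Separation G X
vertexCut⇒Separation {G = G} (k , suc m , (label , _) , components@(_ , surj , _) , k<m) =
  components⇒Separation components (≤-trans (s≤s 1≤k) k<m)
  where
  v∉∅ : ∀ {v} → v ∉ ∅
  v∉∅ v∈∅ = contradiction (∈-tabulate⁻ _ v∈∅) λ ()
  1≤k = ≤-trans (s≤s z≤n) (toℕ<n (label (proj₁ (proj₁ (surj zero)) , v∉∅)))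

2∣m⇒2∤1+m : 2 ∣ m → ¬ 2 ∣ suc m
2∣m⇒2∤1+m {m} 2∣m 2∣1+m with ∣1⇒≡1 (∣m+n∣m⇒∣n (subst (2 ∣_) (+-comm 1 m) 2∣1+m) 2∣m)
... | ()

separation⇒3≤∣X∣ : ThreeFactorCritical G → Separation G X → 3 ≤ ∣ X ∣
separation⇒3≤∣X∣ {n} {G} {X} (3<n , critical) separation = ≮⇒≥ ∣X∣≮3
  where
  open Separation separation renaming (inner to c; outer to d)
  U = ∁ ⁅ c ⁆ - d
  d∈∁⁅c⁆ : d ∈ ∁ ⁅ c ⁆
  d∈∁⁅c⁆ = x∉p⇒x∈∁p (x≢y⇒x∉⁅y⁆ λ d≡c → outer∉side (subst (_∈ side) (sym d≡c) inner∈side))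
  X⊆U : X ⊆ U
  X⊆U x∈X = x∈p∧x≢y⇒x∈p-y (x∉p⇒x∈∁p (x≢y⇒x∉⁅y⁆ λ x≡c → inner∉X (subst (_∈ X) x≡c x∈X)))
                            (λ x≡d → outer∉X (subst (_∈ X) x≡d x∈X))
  2≤∣U∣ : 2 ≤ ∣ U ∣
  2≤∣U∣ = s≤s⁻¹ (begin
    3             ≤⟨ ∸-monoˡ-≤ 1 3<n ⟩
    n ∸ 1         ≡⟨ cong (n ∸_) (∣⁅x⁆∣≡1 c) ⟨
    n ∸ ∣ ⁅ c ⁆ ∣ ≡⟨ ∣∁p∣≡n∸∣p∣ ⁅ c ⁆ ⟨
    ∣ ∁ ⁅ c ⁆ ∣   ≡⟨ x∈p⇒suc∣p-x∣≡∣p∣ (∁ ⁅ c ⁆) d∈∁⁅c⁆ ⟨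
    suc ∣ U ∣     ∎)
    where open ≤-Reasoning
  ∣X∣≮3 : ¬ ∣ X ∣ < 3
  ∣X∣≮3 ∣X∣<3 with ⊆-interpolate X⊆U (s≤s⁻¹ ∣X∣<3) 2≤∣U∣
  ... | T , X⊆T , T⊆U , ∣T∣≡2 =
    2∣m⇒2∤1+m (even c c∉T) (subst (2 ∣_) ∣C─S[d]∣≡1+∣C─S[c]∣ (even d d∉T))
    where
    c∉T : c ∉ T
    c∉T c∈T = x∈∁p⇒x∉p (p─q⊆p _ _ (T⊆U c∈T)) (x∈⁅x⁆ c)
    d∉T : d ∉ T
    d∉T d∈T = proj₂ (x∈p─q⁻ _ _ (T⊆U d∈T)) (x∈⁅x⁆ d)
    even : ∀ x → x ∉ T → 2 ∣ ∣ side ─ (T ∪ ⁅ x ⁆) ∣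
    even x x∉T = perfectMatching⇒2∣∣C─S∣ G {side}
      (critical (T ∪ ⁅ x ⁆) (trans (x∉p⇒∣p∪⁅x⁆∣≡∣p∣+1 T x∉T) (cong (_+ 1) ∣T∣≡2)))
      (⊆-trans Nbhd⊆X (⊆-trans X⊆T (p⊆p∪q _)))
    ∣C─S[d]∣≡1+∣C─S[c]∣ : ∣ side ─ (T ∪ ⁅ d ⁆) ∣ ≡ suc ∣ side ─ (T ∪ ⁅ c ⁆) ∣
    ∣C─S[d]∣≡1+∣C─S[c]∣ = trans (cong ∣_∣ (x∉p⇒p─[q∪⁅x⁆]≡p─q side T outer∉side))
      (sym (x∈p─q⇒suc∣p─[q∪⁅x⁆]∣≡∣p─q∣ side T (x∈p∧x∉q⇒x∈p─q inner∈side c∉T)))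

∣Nbhd∣≡3⇒2∣∣C∣ : ∀ (G : Graph n) → ThreeFactorCritical G → ∀ C → ∣ Nbhd G C ∣ ≡ 3 → 2 ∣ ∣ C ∣
∣Nbhd∣≡3⇒2∣∣C∣ G (_ , critical) C ∣N∣≡3 =
  subst (λ p → 2 ∣ ∣ p ∣) C─N≡C (perfectMatching⇒2∣∣C─S∣ G {C} (critical (Nbhd G C) ∣N∣≡3) ⊆-refl)
  where
  C─N≡C : C ─ Nbhd G C ≡ C
  C─N≡C = Empty[p∩q]⇒p─q≡p C (Nbhd G C) λ (v , v∈C∩N) →
    proj₁ (∈-Nbhd⁻ G (proj₂ (x∈p∩q⁻ C _ v∈C∩N))) (proj₁ (x∈p∩q⁻ C _ v∈C∩N))

lemma2p6 : ∀ {n : ℕ} (G : Graph n) → ThreeFactorCritical G →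
    (H : Subgraph G) → ∣ VH H ∣ % 2 ≡ 1 →
    VertexCut G (Nbhd G (VH H)) →
    4 ≤ ∣ Nbhd G (VH H) ∣
lemma2p6 G critical H odd cut =
  ≤∧≢⇒< (separation⇒3≤∣X∣ critical (vertexCut⇒Separation cut)) 3≢∣X∣
  where
  3≢∣X∣ : 3 ≢ ∣ Nbhd G (VH H) ∣
  3≢∣X∣ 3≡∣X∣
    with trans (sym odd) (n∣m⇒m%n≡0 _ 2 (∣Nbhd∣≡3⇒2∣∣C∣ G critical (VH H) (sym 3≡∣X∣)))
  ... | ()
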